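{- Let $G$ be a graph, $t\in\mathbb N$, $\mathcal P\in\{push,pull,pp\}$ and $I_t=I_t^{(\mathcal P)}(G)$. Then $$\mathrm{Var}\big[|I_{t+1}|\,\big|\,I_t\big]\le\mathbb E\big[|I_{t+1}|\,\big|\,I_t\big].$$
   Context: Rumour spreading on a graph $G$ proceeds in synchronous rounds; $I_t^{(\mathcal P)}(G)$ is the set of informed vertices at the beginning of round $t$. In push, every informed vertex chooses a neighbour independently and uniformly at random and informs it. In pull, every uninformed vertex chooses a neighbour independently and uniformly at random and becomes informed if that neighbour is informed. In push\&pull, every vertex chooses a neighbour independently and uniformly at random and if one of the two is informed, both are informed afterwards. -}

module Defs where

open import Data.Bool using (Bool; true; false; _∧_; _∨_; if_then_else_)
open import Data.Nat using (ℕ; zero; suc)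
open import Data.Fin using (Fin; zero; suc; _≟_)
open import Data.List using (List; []; _∷_; length; map; concatMap; allFin; filterᵇ; foldr; lookup)
open import Data.Integer using (+_)
open import Data.Rational using (ℚ; 0ℚ; _+_; _*_; _-_; _/_)
open import Data.Bool.ListAction using (any)
open import Relation.Nullary using (does)
open import Relation.Binary.PropositionalEquality using (_≡_)

record Graph : Set where
  field
    n      : ℕ
    adj    : Fin n → Fin n → Bool
    sym    : ∀ u v → adj u v ≡ adj v u
    irrefl : ∀ v → adj v v ≡ false
open Graph public

nbrs : (G : Graph) → Fin (n G) → List (Fin (n G))
nbrs G v = filterᵇ (adj G v) (allFin (n G))

deg : (G : Graph) → Fin (n G) → ℕ
deg G v = length (nbrs G v)

nbr : (G : Graph) → (v : Fin (n G)) → Fin (deg G v) → Fin (n G)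
nbr G v i = lookup (nbrs G v) i

-- A choice profile of one round: every vertex v picks a neighbour,
-- encoded by its index in nbrs G v.
Profile : Graph → Set
Profile G = (v : Fin (n G)) → Fin (deg G v)

-- Enumeration of all dependent functions (i : Fin k) → Fin (d i);
-- every such function appears exactly once.
consF : ∀ {k} {d : Fin (suc k) → ℕ} → Fin (d zero) →
        ((i : Fin k) → Fin (d (suc i))) → (i : Fin (suc k)) → Fin (d i)
consF j f zero    = j
consF j f (suc i) = f i

allFuns : (k : ℕ) (d : Fin k → ℕ) → List ((i : Fin k) → Fin (d i))
allFuns zero    d = (λ ()) ∷ []
allFuns (suc k) d =
  concatMap (λ j → map (consF {k} {d} j) (allFuns k (λ i → d (suc i))))
            (allFin (d zero))

-- The sample space of one round: all choice profiles, each equally likely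
-- (independent uniform choices of a neighbour by each vertex).
allProfiles : (G : Graph) → List (Profile G)
allProfiles G = allFuns (n G) (deg G)

VSet : Graph → Set
VSet G = Fin (n G) → Bool

data Protocol : Set where
  push pull pushpull : Protocol

pushedTo : (G : Graph) → VSet G → Profile G → Fin (n G) → Bool
pushedTo G S c w = any (λ v → S v ∧ does (nbr G v (c v) ≟ w)) (allFin (n G))

step : (G : Graph) → Protocol → VSet G → Profile G → VSet G
step G push     S c w = S w ∨ pushedTo G S c w
step G pull     S c w = S w ∨ S (nbr G w (c w))
step G pushpull S c w = S w ∨ S (nbr G w (c w)) ∨ pushedTo G S c w

card : (G : Graph) → VSet G → ℕ
card G S = foldr (λ v acc → if S v then suc acc else acc) 0 (allFin (n G))

-- Expectation and variance of a random variable on a finite uniform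
-- sample space, given as the list of its values at the sample points.
sumℚ : List ℚ → ℚ
sumℚ = foldr _+_ 0ℚ

mean : List ℚ → ℚ
mean []       = 0ℚ
mean (x ∷ xs) = sumℚ (x ∷ xs) * ((+ 1) / suc (length xs))

variance : List ℚ → ℚ
variance xs = mean (map (λ x → (x - mean xs) * (x - mean xs)) xs)

-- |I_{t+1}| as a random variable given I_t = S (values over all profiles)
nextSize : (G : Graph) → Protocol → VSet G → List ℚ
nextSize G P S = map (λ c → (+ card G (step G P S c)) / 1) (allProfiles G)

condE : (G : Graph) → Protocol → VSet G → ℚ
condE G P S = mean (nextSize G P S)

condVar : (G : Graph) → Protocol → VSet G → ℚ
condVar G P S = variance (nextSize G P S)

module Submission where

-- Given I_t = S, the round is driven by independent uniform choices
-- c v of a neighbour, and |I_{t+1}| = Σ_w 1[w informed].  It suffices that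
-- the events "w informed" and "w' informed" are negatively correlated for
-- w ≠ w': then Var = Σ_{w,w'} Cov ≤ Σ_w Var 1[w] ≤ Σ_w P[w] = E.  If w or w'
-- is already informed the event is sure.  Otherwise "w stays uninformed" is
-- a product event ⋀_v (c v spares w) over the independent coordinates, and
-- per coordinate the two sparing events cover everything (one choice never
-- informs two distinct uninformed vertices); covering events are negatively
-- correlated, this passes to product events, and Cov(¬Y,¬Y') = Cov(Y,Y').

module Counting where
  open import Data.Bool using (Bool; true; false; _∧_; _∨_; not; if_then_else_)
  open import Data.Bool.Properties using (∧-comm; ∧-idem)
  open import Data.Nat using (ℕ; zero; suc; _+_; _*_; _≤_; z≤n)
  open import Data.Nat.Properties hiding (_≟_)
  open import Data.Nat.Tactic.RingSolver using (solve-∀)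
  open import Data.List using (List; []; _∷_; length; map; concatMap; concat; allFin; _++_; tabulate)
  open import Data.Fin using (Fin; zero; suc; _≟_)
  open import Relation.Nullary using (does; yes; no; ¬_)
  open import Relation.Binary.PropositionalEquality
  open import Defs using (allFuns; consF)

  sumL : {A : Set} → (A → ℕ) → List A → ℕ
  sumL f []       = 0
  sumL f (x ∷ xs) = f x + sumL f xs

  sumL-cong : {A : Set} {f g : A → ℕ} → (∀ x → f x ≡ g x) → ∀ L → sumL f L ≡ sumL g L
  sumL-cong e []      = refl
  sumL-cong e (x ∷ L) = cong₂ _+_ (e x) (sumL-cong e L)

  sumL-mono : {A : Set} {f g : A → ℕ} → (∀ x → f x ≤ g x) → ∀ L → sumL f L ≤ sumL g L
  sumL-mono e []      = z≤n
  sumL-mono e (x ∷ L) = +-mono-≤ (e x) (sumL-mono e L)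

  sumL-zero : {A : Set} (L : List A) → sumL (λ _ → 0) L ≡ 0
  sumL-zero []      = refl
  sumL-zero (_ ∷ L) = sumL-zero L

  sumL-+ : {A : Set} (f g : A → ℕ) → ∀ L → sumL (λ x → f x + g x) L ≡ sumL f L + sumL g L
  sumL-+ f g []      = refl
  sumL-+ f g (x ∷ L) rewrite sumL-+ f g L = interchange (f x) (g x) (sumL f L) (sumL g L)
    where
    interchange : ∀ a b c d → a + b + (c + d) ≡ a + c + (b + d)
    interchange = solve-∀

  sumL-*ˡ : {A : Set} (k : ℕ) (f : A → ℕ) → ∀ L → sumL (λ x → k * f x) L ≡ k * sumL f L
  sumL-*ˡ k f []      = sym (*-zeroʳ k)
  sumL-*ˡ k f (x ∷ L) rewrite sumL-*ˡ k f L = sym (*-distribˡ-+ k (f x) (sumL f L))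

  sumL-*ʳ : {A : Set} (k : ℕ) (f : A → ℕ) → ∀ L → sumL (λ x → f x * k) L ≡ sumL f L * k
  sumL-*ʳ k f []      = refl
  sumL-*ʳ k f (x ∷ L) rewrite sumL-*ʳ k f L = sym (*-distribʳ-+ k (f x) (sumL f L))

  sumL-swap : {A B : Set} (h : A → B → ℕ) → ∀ L M →
    sumL (λ a → sumL (h a) M) L ≡ sumL (λ b → sumL (λ a → h a b) L) M
  sumL-swap h []      M = sym (sumL-zero M)
  sumL-swap h (a ∷ L) M = begin
      sumL (h a) M + sumL (λ a → sumL (h a) M) L
    ≡⟨ cong (sumL (h a) M +_) (sumL-swap h L M) ⟩
      sumL (h a) M + sumL (λ b → sumL (λ a → h a b) L) M
    ≡⟨ sym (sumL-+ (h a) (λ b → sumL (λ a → h a b) L) M) ⟩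
      sumL (λ b → h a b + sumL (λ a → h a b) L) M
    ∎
    where open ≡-Reasoning

  sumL-square : {A : Set} (f : A → ℕ) (V : List A) →
    sumL f V * sumL f V ≡ sumL (λ w → sumL (λ w' → f w * f w') V) V
  sumL-square f V = trans (sym (sumL-*ʳ (sumL f V) f V)) (sumL-cong (λ w → sym (sumL-*ˡ (f w) f V)) V)

  sumL-++ : {A : Set} (f : A → ℕ) → ∀ L M → sumL f (L ++ M) ≡ sumL f L + sumL f M
  sumL-++ f []      M = refl
  sumL-++ f (x ∷ L) M rewrite sumL-++ f L M = sym (+-assoc (f x) (sumL f L) (sumL f M))

  sumL-map : {A B : Set} (f : B → ℕ) (g : A → B) → ∀ L → sumL f (map g L) ≡ sumL (λ x → f (g x)) L
  sumL-map f g []      = refl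
  sumL-map f g (x ∷ L) = cong (f (g x) +_) (sumL-map f g L)

  sumL-concatMap : {A B : Set} (f : B → ℕ) (g : A → List B) → ∀ L →
    sumL f (concatMap g L) ≡ sumL (λ x → sumL f (g x)) L
  sumL-concatMap f g []      = refl
  sumL-concatMap f g (x ∷ L) =
    trans (sumL-++ f (g x) (concat (map g L))) (cong (sumL f (g x) +_) (sumL-concatMap f g L))

  sumL-tabulate : ∀ k {A : Set} (f : A → ℕ) (g : Fin k → A) →
    sumL f (tabulate g) ≡ sumL (λ i → f (g i)) (allFin k)
  sumL-tabulate zero    f g = refl
  sumL-tabulate (suc k) f g = cong (f (g zero) +_)
    (trans (sumL-tabulate k f (λ i → g (suc i))) (sym (sumL-tabulate k (λ i → f (g i)) suc)))

  sumL-delta : ∀ k (w : Fin k) (x : ℕ) →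
    sumL (λ w' → if does (w ≟ w') then x else 0) (allFin k) ≡ x
  sumL-delta (suc k) zero    x =
    trans (cong (x +_) (trans (sumL-tabulate k _ suc) (sumL-zero (allFin k)))) (+-identityʳ x)
  sumL-delta (suc k) (suc w) x = trans (sumL-tabulate k _ suc) (sumL-delta k w x)

  ind : Bool → ℕ
  ind true  = 1
  ind false = 0

  count : {A : Set} → (A → Bool) → List A → ℕ
  count p = sumL (λ x → ind (p x))

  ind-∧ : ∀ a b → ind (a ∧ b) ≡ ind a * ind b
  ind-∧ true  b = sym (+-identityʳ (ind b))
  ind-∧ false b = refl

  count-cong : {A : Set} {p q : A → Bool} → (∀ x → p x ≡ q x) → ∀ L → count p L ≡ count q L
  count-cong e = sumL-cong (λ x → cong ind (e x))

  count-true : {A : Set} (L : List A) → count (λ _ → true) L ≡ length L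
  count-true []      = refl
  count-true (x ∷ L) = cong suc (count-true L)

  count-split : {A : Set} (p q : A → Bool) → ∀ L →
    count p L ≡ count (λ x → p x ∧ q x) L + count (λ x → p x ∧ not (q x)) L
  count-split p q L = trans (sumL-cong split L) (sumL-+ _ _ L)
    where
    split : ∀ x → ind (p x) ≡ ind (p x ∧ q x) + ind (p x ∧ not (q x))
    split x with p x | q x
    ... | true  | true  = refl
    ... | true  | false = refl
    ... | false | _     = refl

  -- Two events are negatively correlated on the uniform space L when
  -- P[Y ∧ Y'] ≤ P[Y] P[Y'], cleared of denominators.
  NegCorr : {A : Set} → List A → (A → Bool) → (A → Bool) → Set
  NegCorr L Y Y' = length L * count (λ x → Y x ∧ Y' x) L ≤ count Y L * count Y' L

  NegCorr-cong : {A : Set} (L : List A) {Y Y' Z Z' : A → Bool} →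
    (∀ x → Y x ≡ Z x) → (∀ x → Y' x ≡ Z' x) → NegCorr L Z Z' → NegCorr L Y Y'
  NegCorr-cong L e e' = subst₂ _≤_
    (cong (length L *_) (sym (count-cong (λ x → cong₂ _∧_ (e x) (e' x)) L)))
    (sym (cong₂ _*_ (count-cong e L) (count-cong e' L)))

  NegCorr-sym : {A : Set} (L : List A) {Y Y' : A → Bool} → NegCorr L Y Y' → NegCorr L Y' Y
  NegCorr-sym L {Y} {Y'} h = subst₂ _≤_
    (cong (length L *_) (count-cong (λ x → ∧-comm (Y x) (Y' x)) L)) (*-comm (count Y L) (count Y' L)) h

  NegCorr-sure : {A : Set} (L : List A) {Y Y' : A → Bool} → (∀ x → Y x ≡ true) → NegCorr L Y Y'
  NegCorr-sure L {Y} {Y'} sure = ≤-reflexive (begin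
      length L * count (λ x → Y x ∧ Y' x) L
    ≡⟨ cong₂ _*_ (sym (count-true L)) (count-cong (λ x → cong (_∧ Y' x) (sure x)) L) ⟩
      count (λ _ → true) L * count Y' L
    ≡⟨ cong (_* count Y' L) (sym (count-cong sure L)) ⟩
      count Y L * count Y' L
    ∎)
    where open ≡-Reasoning

  -- Cov(Y,Y') = Cov(¬Y,¬Y'): in counts, with N = |L|,
  -- N·#(Y∧Y') + #¬Y·#¬Y' = N·#(¬Y∧¬Y') + #Y·#Y'.
  covariance-complement : {A : Set} (L : List A) (Y Y' : A → Bool) →
    length L * count (λ x → Y x ∧ Y' x) L + count (λ x → not (Y x)) L * count (λ x → not (Y' x)) L
    ≡ length L * count (λ x → not (Y x) ∧ not (Y' x)) L + count Y L * count Y' L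
  covariance-complement L Y Y' = begin
      length L * d + count nY L * count nY' L
    ≡⟨ cong₂ (λ m k → m * d + k) eN (cong₂ _*_ enY enY') ⟩
      ((d + b) + (c + a)) * d + (c + a) * (b + a)
    ≡⟨ cells d b c a ⟩
      ((d + b) + (c + a)) * a + (d + b) * (d + c)
    ≡⟨ sym (cong₂ (λ m k → m * a + k) eN (cong₂ _*_ eY eY')) ⟩
      length L * a + count Y L * count Y' L
    ∎
    where
    open ≡-Reasoning
    nY nY' : _ → Bool
    nY x = not (Y x)
    nY' x = not (Y' x)
    a = count (λ x → nY x ∧ nY' x) L
    b = count (λ x → Y x ∧ nY' x) L
    c = count (λ x → nY x ∧ Y' x) L
    d = count (λ x → Y x ∧ Y' x) L
    eY : count Y L ≡ d + b
    eY = count-split Y Y' L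
    enY : count nY L ≡ c + a
    enY = count-split nY Y' L
    eY' : count Y' L ≡ d + c
    eY' = trans (count-split Y' Y L)
                (cong₂ _+_ (count-cong (λ x → ∧-comm (Y' x) (Y x)) L) (count-cong (λ x → ∧-comm (Y' x) (nY x)) L))
    enY' : count nY' L ≡ b + a
    enY' = trans (count-split nY' Y L)
                 (cong₂ _+_ (count-cong (λ x → ∧-comm (nY' x) (Y x)) L) (count-cong (λ x → ∧-comm (nY' x) (nY x)) L))
    eN : length L ≡ (d + b) + (c + a)
    eN = trans (sym (count-true L)) (trans (count-split (λ _ → true) Y L) (cong₂ _+_ eY enY))
    cells : ∀ d b c a → ((d + b) + (c + a)) * d + (c + a) * (b + a) ≡ ((d + b) + (c + a)) * a + (d + b) * (d + c)
    cells = solve-∀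

  NegCorr-complement : {A : Set} (L : List A) (Y Y' : A → Bool) →
    NegCorr L (λ x → not (Y x)) (λ x → not (Y' x)) → NegCorr L Y Y'
  NegCorr-complement L Y Y' h = +-cancelʳ-≤ (count nY L * count nY' L) _ _ (begin
      length L * count (λ x → Y x ∧ Y' x) L + count nY L * count nY' L
    ≡⟨ covariance-complement L Y Y' ⟩
      length L * count (λ x → nY x ∧ nY' x) L + count Y L * count Y' L
    ≤⟨ +-monoˡ-≤ (count Y L * count Y' L) h ⟩
      count nY L * count nY' L + count Y L * count Y' L
    ≡⟨ +-comm (count nY L * count nY' L) _ ⟩
      count Y L * count Y' L + count nY L * count nY' L
    ∎)
    where
    open ≤-Reasoning
    nY nY' : _ → Bool
    nY x = not (Y x)
    nY' x = not (Y' x)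

  -- Two events that together cover the space are negatively correlated:
  -- their complements are disjoint.
  NegCorr-cover : {A : Set} (L : List A) (f g : A → Bool) → (∀ x → f x ∨ g x ≡ true) → NegCorr L f g
  NegCorr-cover L f g cover = NegCorr-complement L f g (begin
      length L * count (λ x → not (f x) ∧ not (g x)) L
    ≡⟨ cong (length L *_) (trans (count-cong disjoint L) (sumL-zero L)) ⟩
      length L * 0
    ≡⟨ *-zeroʳ (length L) ⟩
      0
    ≤⟨ z≤n ⟩
      count (λ x → not (f x)) L * count (λ x → not (g x)) L
    ∎)
    where
    open ≤-Reasoning
    disjoint : ∀ x → not (f x) ∧ not (g x) ≡ false
    disjoint x with f x | g x | cover x
    ... | true  | _     | _ = refl
    ... | false | true  | _ = refl

  -- Product spaces: allFuns k d enumerates (i : Fin k) → Fin (d i), i.e.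
  -- independent uniform coordinates. A product event asks that every
  -- coordinate c i satisfy its own event f i.
  every : (k : ℕ) → (Fin k → Bool) → Bool
  every zero    f = true
  every (suc k) f = f zero ∧ every k (λ i → f (suc i))

  productEvent : ∀ k {d : Fin k → ℕ} → ((i : Fin k) → Fin (d i) → Bool) → ((i : Fin k) → Fin (d i)) → Bool
  productEvent k f c = every k (λ i → f i (c i))

  prodN : (k : ℕ) → (Fin k → ℕ) → ℕ
  prodN zero    f = 1
  prodN (suc k) f = f zero * prodN k (λ i → f (suc i))

  prodN-cong : ∀ k {f g : Fin k → ℕ} → (∀ i → f i ≡ g i) → prodN k f ≡ prodN k g
  prodN-cong zero    e = refl
  prodN-cong (suc k) e = cong₂ _*_ (e zero) (prodN-cong k (λ i → e (suc i)))

  count-∧-const : {A : Set} (b : Bool) (p : A → Bool) → ∀ L → count (λ x → b ∧ p x) L ≡ ind b * count p L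
  count-∧-const true  p L = sym (+-identityʳ (count p L))
  count-∧-const false p L = sumL-zero L

  count-product : ∀ k (d : Fin k → ℕ) (f : (i : Fin k) → Fin (d i) → Bool) →
    count (productEvent k f) (allFuns k d) ≡ prodN k (λ i → count (f i) (allFin (d i)))
  count-product zero    d f = refl
  count-product (suc k) d f = begin
      count (productEvent (suc k) f) (concatMap (λ j → map (consF {k} {d} j) rest) (allFin (d zero)))
    ≡⟨ sumL-concatMap _ _ (allFin (d zero)) ⟩
      sumL (λ j → count (productEvent (suc k) f) (map (consF {k} {d} j) rest)) (allFin (d zero))
    ≡⟨ sumL-cong (λ j → sumL-map _ (consF {k} {d} j) rest) (allFin (d zero)) ⟩
      sumL (λ j → count (λ c → f zero j ∧ productEvent k f′ c) rest) (allFin (d zero))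
    ≡⟨ sumL-cong (λ j → count-∧-const (f zero j) (productEvent k f′) rest) (allFin (d zero)) ⟩
      sumL (λ j → ind (f zero j) * count (productEvent k f′) rest) (allFin (d zero))
    ≡⟨ sumL-*ʳ _ (λ j → ind (f zero j)) (allFin (d zero)) ⟩
      count (f zero) (allFin (d zero)) * count (productEvent k f′) rest
    ≡⟨ cong (count (f zero) (allFin (d zero)) *_) (count-product k (λ i → d (suc i)) f′) ⟩
      prodN (suc k) (λ i → count (f i) (allFin (d i)))
    ∎
    where
    open ≡-Reasoning
    rest = allFuns k (λ i → d (suc i))
    f′ : (i : Fin k) → Fin (d (suc i)) → Bool
    f′ i = f (suc i)

  every-∧ : ∀ k (f g : Fin k → Bool) → every k (λ i → f i ∧ g i) ≡ every k f ∧ every k g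
  every-∧ zero    f g = refl
  every-∧ (suc k) f g rewrite every-∧ k (λ i → f (suc i)) (λ i → g (suc i)) =
    interchange (f zero) (g zero) (every k (λ i → f (suc i))) (every k (λ i → g (suc i)))
    where
    interchange : ∀ a b c e → (a ∧ b) ∧ (c ∧ e) ≡ (a ∧ c) ∧ (b ∧ e)
    interchange false b     c     e = refl
    interchange true  true  c     e = refl
    interchange true  false true  e = refl
    interchange true  false false e = refl

  every-true : ∀ k → every k (λ _ → true) ≡ true
  every-true zero    = refl
  every-true (suc k) = every-true k

  prodN-cross : ∀ k (N F G H : Fin k → ℕ) → (∀ i → N i * H i ≤ F i * G i) →
    prodN k N * prodN k H ≤ prodN k F * prodN k G
  prodN-cross zero    N F G H h = ≤-refl
  prodN-cross (suc k) N F G H h = subst₂ _≤_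
    (regroup (N zero) (H zero) (prodN k (λ i → N (suc i))) (prodN k (λ i → H (suc i))))
    (regroup (F zero) (G zero) (prodN k (λ i → F (suc i))) (prodN k (λ i → G (suc i))))
    (*-mono-≤ (h zero) (prodN-cross k _ _ _ _ (λ i → h (suc i))))
    where
    regroup : ∀ a b c e → (a * b) * (c * e) ≡ (a * c) * (b * e)
    regroup = solve-∀

  NegCorr-product : ∀ k (d : Fin k → ℕ) (f g : (i : Fin k) → Fin (d i) → Bool) →
    (∀ i → NegCorr (allFin (d i)) (f i) (g i)) →
    NegCorr (allFuns k d) (productEvent k f) (productEvent k g)
  NegCorr-product k d f g h = subst₂ _≤_
    (sym (cong₂ _*_ eN e∧)) (sym (cong₂ _*_ (count-product k d f) (count-product k d g)))
    (prodN-cross k _ _ _ _ h)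
    where
    eN : length (allFuns k d) ≡ prodN k (λ i → length (allFin (d i)))
    eN = begin
        length (allFuns k d)
      ≡⟨ sym (count-true (allFuns k d)) ⟩
        count (λ _ → true) (allFuns k d)
      ≡⟨ count-cong (λ _ → sym (every-true k)) (allFuns k d) ⟩
        count (productEvent k (λ _ _ → true)) (allFuns k d)
      ≡⟨ count-product k d (λ _ _ → true) ⟩
        prodN k (λ i → count (λ _ → true) (allFin (d i)))
      ≡⟨ prodN-cong k (λ i → count-true (allFin (d i))) ⟩
        prodN k (λ i → length (allFin (d i)))
      ∎
      where open ≡-Reasoning
    e∧ : count (λ c → productEvent k f c ∧ productEvent k g c) (allFuns k d)
         ≡ prodN k (λ i → count (λ j → f i j ∧ g i j) (allFin (d i)))
    e∧ = trans (count-cong (λ c → sym (every-∧ k (λ i → f i (c i)) (λ i → g i (c i)))) (allFuns k d))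
               (count-product k d (λ i j → f i j ∧ g i j))

  indicatorSum : {A : Set} (k : ℕ) → (Fin k → A → Bool) → A → ℕ
  indicatorSum k Y c = count (λ w → Y w c) (allFin k)

  sum-indicatorSum : {A : Set} (L : List A) (k : ℕ) (Y : Fin k → A → Bool) →
    sumL (indicatorSum k Y) L ≡ sumL (λ w → count (Y w) L) (allFin k)
  sum-indicatorSum L k Y = sumL-swap (λ c w → ind (Y w c)) L (allFin k)

  sum-indicatorSum-square : {A : Set} (L : List A) (k : ℕ) (Y : Fin k → A → Bool) →
    sumL (λ c → indicatorSum k Y c * indicatorSum k Y c) L
    ≡ sumL (λ w → sumL (λ w' → count (λ c → Y w c ∧ Y w' c) L) (allFin k)) (allFin k)
  sum-indicatorSum-square L k Y = begin
      sumL (λ c → indicatorSum k Y c * indicatorSum k Y c) L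
    ≡⟨ sumL-cong (λ c → sumL-square (λ w → y w c) V) L ⟩
      sumL (λ c → sumL (λ w → sumL (λ w' → y w c * y w' c) V) V) L
    ≡⟨ sumL-swap (λ c w → sumL (λ w' → y w c * y w' c) V) L V ⟩
      sumL (λ w → sumL (λ c → sumL (λ w' → y w c * y w' c) V) L) V
    ≡⟨ sumL-cong (λ w → sumL-swap (λ c w' → y w c * y w' c) L V) V ⟩
      sumL (λ w → sumL (λ w' → sumL (λ c → y w c * y w' c) L) V) V
    ≡⟨ sumL-cong (λ w → sumL-cong (λ w' → sumL-cong (λ c → sym (ind-∧ (Y w c) (Y w' c))) L) V) V ⟩
      sumL (λ w → sumL (λ w' → count (λ c → Y w c ∧ Y w' c) L) V) V
    ∎
    where
    open ≡-Reasoning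
    V = allFin k
    y : Fin k → _ → ℕ
    y w c = ind (Y w c)

  -- If the indicators are pairwise negatively correlated, then
  -- Var X ≤ E X, i.e.  N·Σ X² ≤ (Σ X)² + N·Σ X  with N = |L|.
  variance-bound : {A : Set} (L : List A) (k : ℕ) (Y : Fin k → A → Bool) →
    (∀ w w' → ¬ w ≡ w' → NegCorr L (Y w) (Y w')) →
    length L * sumL (λ c → indicatorSum k Y c * indicatorSum k Y c) L
    ≤ sumL (indicatorSum k Y) L * sumL (indicatorSum k Y) L + length L * sumL (indicatorSum k Y) L
  variance-bound L k Y negCorr = begin
      N * sumL (λ c → indicatorSum k Y c * indicatorSum k Y c) L
    ≡⟨ cong (N *_) (sum-indicatorSum-square L k Y) ⟩
      N * sumL (λ w → sumL (λ w' → joint w w') V) V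
    ≡⟨ trans (sym (sumL-*ˡ N _ V)) (sumL-cong (λ w → sym (sumL-*ˡ N (joint w) V)) V) ⟩
      sumL (λ w → sumL (λ w' → N * joint w w') V) V
    ≤⟨ sumL-mono (λ w → sumL-mono (pair-bound w) V) V ⟩
      sumL (λ w → sumL (λ w' → p w * p w' + diagonal w w') V) V
    ≡⟨ trans (sumL-cong (λ w → sumL-+ _ _ V) V) (sumL-+ _ _ V) ⟩
      sumL (λ w → sumL (λ w' → p w * p w') V) V + sumL (λ w → sumL (diagonal w) V) V
    ≡⟨ cong₂ _+_ (sym (sumL-square p V)) (trans (sumL-cong (λ w → sumL-delta k w (N * p w)) V) (sumL-*ˡ N p V)) ⟩
      sumL p V * sumL p V + N * sumL p V
    ≡⟨ cong (λ m → m * m + N * m) (sym (sum-indicatorSum L k Y)) ⟩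
      sumL (indicatorSum k Y) L * sumL (indicatorSum k Y) L + N * sumL (indicatorSum k Y) L
    ∎
    where
    open ≤-Reasoning
    N = length L
    V = allFin k
    p : Fin k → ℕ
    p w = count (Y w) L
    joint : Fin k → Fin k → ℕ
    joint w w' = count (λ c → Y w c ∧ Y w' c) L
    diagonal : Fin k → Fin k → ℕ
    diagonal w w' = if does (w ≟ w') then N * p w else 0
    -- off the diagonal use negative correlation, on it use Y ∧ Y = Y
    pair-bound : ∀ w w' → N * joint w w' ≤ p w * p w' + diagonal w w'
    pair-bound w w' with w ≟ w'
    ... | yes refl = subst (λ m → N * m ≤ p w * p w + N * p w)
                           (sym (sumL-cong (λ c → cong ind (∧-idem (Y w c))) L)) (m≤n+m (N * p w) (p w * p w))
    ... | no w≢w' = ≤-trans (negCorr w w' w≢w') (m≤m+n (p w * p w') 0)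

module OneRound where
  open import Data.Bool using (Bool; true; false; _∧_; _∨_; not; if_then_else_)
  open import Data.Bool.Properties using (∧-comm; ∧-identityʳ)
  open import Data.Nat using (zero; suc; _+_; _*_; _≤_)
  open import Data.List using (List; []; _∷_; length; allFin; foldr; tabulate)
  open import Data.Bool.ListAction using (any)
  open import Data.Fin using (Fin; zero; suc; _≟_)
  open import Data.Empty using (⊥; ⊥-elim)
  open import Data.Sum using (_⊎_; inj₁; inj₂)
  open import Data.Product using (_×_; _,_)
  open import Relation.Nullary using (does; yes; ¬_)
  open import Relation.Binary.PropositionalEquality
  open import Defs hiding (sym)
  open Counting

  pushes pulls : Protocol → Bool
  pushes push     = true
  pushes pull     = false
  pushes pushpull = true
  pulls push     = false
  pulls pull     = true
  pulls pushpull = true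

  spares : (G : Graph) → Protocol → VSet G → Fin (n G) → (v : Fin (n G)) → Fin (deg G v) → Bool
  spares G P S w v j =
    not (pushes P ∧ (S v ∧ does (nbr G v j ≟ w))) ∧ not (pulls P ∧ (does (v ≟ w) ∧ S (nbr G v j)))

  not-∨ : ∀ a b → not (a ∨ b) ≡ not a ∧ not b
  not-∨ true  b = refl
  not-∨ false b = refl

  every-cong : ∀ k {f g : Fin k → Bool} → (∀ i → f i ≡ g i) → every k f ≡ every k g
  every-cong zero    e = refl
  every-cong (suc k) e = cong₂ _∧_ (e zero) (every-cong k (λ i → e (suc i)))

  not-any : ∀ {A : Set} k (p : A → Bool) (g : Fin k → A) →
    not (any p (tabulate g)) ≡ every k (λ i → not (p (g i)))
  not-any zero    p g = refl
  not-any (suc k) p g with p (g zero)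
  ... | true  = refl
  ... | false = not-any k p (λ i → g (suc i))

  every-at : ∀ k (w : Fin k) (q : Fin k → Bool) → every k (λ v → not (does (v ≟ w) ∧ q v)) ≡ not (q w)
  every-at (suc k) zero    q = trans (cong (not (q zero) ∧_) (every-true k)) (∧-identityʳ _)
  every-at (suc k) (suc w) q = every-at k w (λ i → q (suc i))

  uninformed-product : (G : Graph) (P : Protocol) (S : VSet G) (c : Profile G) (w : Fin (n G)) →
    S w ≡ false → not (step G P S c w) ≡ productEvent (n G) (spares G P S w) c
  uninformed-product G push S c w sw rewrite sw =
    trans (not-any (n G) (λ v → S v ∧ does (nbr G v (c v) ≟ w)) (λ i → i))
          (every-cong (n G) (λ v → sym (∧-identityʳ _)))
  uninformed-product G pull S c w sw rewrite sw = sym (every-at (n G) w (λ v → S (nbr G v (c v))))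
  uninformed-product G pushpull S c w sw rewrite sw = begin
      not (S (nbr G w (c w)) ∨ pushedTo G S c w)
    ≡⟨ trans (not-∨ (S (nbr G w (c w))) _) (∧-comm (not (S (nbr G w (c w)))) _) ⟩
      not (pushedTo G S c w) ∧ not (S (nbr G w (c w)))
    ≡⟨ cong₂ _∧_ (not-any (n G) (λ v → S v ∧ does (nbr G v (c v) ≟ w)) (λ i → i))
                 (sym (every-at (n G) w (λ v → S (nbr G v (c v))))) ⟩
      every (n G) (λ v → not (S v ∧ does (nbr G v (c v) ≟ w))) ∧ every (n G) (λ v → not (does (v ≟ w) ∧ S (nbr G v (c v))))
    ≡⟨ sym (every-∧ (n G) _ _) ⟩
      productEvent (n G) (spares G pushpull S w) c
    ∎
    where open ≡-Reasoning

  informed-stays : (G : Graph) (P : Protocol) (S : VSet G) (c : Profile G) (w : Fin (n G)) →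
    S w ≡ true → step G P S c w ≡ true
  informed-stays G push     S c w sw rewrite sw = refl
  informed-stays G pull     S c w sw rewrite sw = refl
  informed-stays G pushpull S c w sw rewrite sw = refl

  ∧-true : ∀ a b → a ∧ b ≡ true → (a ≡ true) × (b ≡ true)
  ∧-true true true _ = refl , refl

  not-∧-not-false : ∀ a b → not a ∧ not b ≡ false → (a ≡ true) ⊎ (b ≡ true)
  not-∧-not-false true  b    _ = inj₁ refl
  not-∧-not-false false true _ = inj₂ refl

  does-true : ∀ {k} (x y : Fin k) → does (x ≟ y) ≡ true → x ≡ y
  does-true x y e with x ≟ y
  ... | yes x≡y = x≡y

  spares-false : (G : Graph) (P : Protocol) (S : VSet G) (w v : Fin (n G)) (j : Fin (deg G v)) →
    spares G P S w v j ≡ false → ((S v ≡ true) × (nbr G v j ≡ w)) ⊎ (v ≡ w)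
  spares-false G P S w v j e
    with not-∧-not-false (pushes P ∧ (S v ∧ does (nbr G v j ≟ w))) (pulls P ∧ (does (v ≟ w) ∧ S (nbr G v j))) e
  ... | inj₁ pushed with ∧-true (pushes P) _ pushed
  ...   | _ , hit with ∧-true (S v) _ hit
  ...     | sv , target = inj₁ (sv , does-true _ _ target)
  spares-false G P S w v j e | inj₂ pulled with ∧-true (pulls P) _ pulled
  ...   | _ , hit with ∧-true (does (v ≟ w)) _ hit
  ...     | self , _ = inj₂ (does-true _ _ self)

  true≢false : true ≡ false → ⊥
  true≢false ()

  -- One choice never informs two distinct uninformed vertices: pushing only
  -- reaches one target, and pulling only informs the (uninformed) chooser,
  -- who then cannot also push.
  spares-cover : (G : Graph) (P : Protocol) (S : VSet G) (w w' : Fin (n G)) →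
    ¬ w ≡ w' → S w ≡ false → S w' ≡ false →
    ∀ v j → spares G P S w v j ∨ spares G P S w' v j ≡ true
  spares-cover G P S w w' w≢w' sw sw' v j with spares G P S w v j in e | spares G P S w' v j in e'
  ... | true  | _    = refl
  ... | false | true = refl
  ... | false | false with spares-false G P S w v j e | spares-false G P S w' v j e'
  ...   | inj₁ (_ , to-w) | inj₁ (_ , to-w') = ⊥-elim (w≢w' (trans (sym to-w) to-w'))
  ...   | inj₁ (sv , _)   | inj₂ refl        = ⊥-elim (true≢false (trans (sym sv) sw'))
  ...   | inj₂ refl       | inj₁ (sv , _)    = ⊥-elim (true≢false (trans (sym sv) sw))
  ...   | inj₂ refl       | inj₂ v≡w'        = ⊥-elim (w≢w' v≡w')

  informed-NegCorr : (G : Graph) (P : Protocol) (S : VSet G) (w w' : Fin (n G)) → ¬ w ≡ w' →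
    NegCorr (allProfiles G) (λ c → step G P S c w) (λ c → step G P S c w')
  informed-NegCorr G P S w w' w≢w' with S w in sw | S w' in sw'
  ... | true  | _     = NegCorr-sure (allProfiles G) (λ c → informed-stays G P S c w sw)
  ... | false | true  = NegCorr-sym (allProfiles G) (NegCorr-sure (allProfiles G) (λ c → informed-stays G P S c w' sw'))
  ... | false | false = NegCorr-complement (allProfiles G) _ _
        (NegCorr-cong (allProfiles G) (λ c → uninformed-product G P S c w sw) (λ c → uninformed-product G P S c w' sw')
          (NegCorr-product (n G) (deg G) (spares G P S w) (spares G P S w')
            (λ v → NegCorr-cover (allFin (deg G v)) _ _ (spares-cover G P S w w' w≢w' sw sw' v))))

  card-count : (G : Graph) (T : VSet G) → card G T ≡ count T (allFin (n G))
  card-count G T = go (allFin (n G))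
    where
    go : (L : List (Fin (n G))) → foldr (λ v acc → if T v then suc acc else acc) 0 L ≡ count T L
    go []      = refl
    go (v ∷ L) with T v
    ... | true  = cong suc (go L)
    ... | false = go L

  informed-count-bound : (G : Graph) (P : Protocol) (S : VSet G) →
    let L = allProfiles G
        X = λ (c : Profile G) → card G (step G P S c) in
    length L * sumL (λ c → X c * X c) L ≤ sumL X L * sumL X L + length L * sumL X L
  informed-count-bound G P S = subst₂ _≤_
    (cong (length L *_) (sym (sumL-cong (λ c → cong₂ _*_ (X≡ c) (X≡ c)) L)))
    (cong (λ m → m * m + length L * m) (sym (sumL-cong X≡ L)))
    (variance-bound L (n G) (λ w c → step G P S c w) (informed-NegCorr G P S))
    where
    L = allProfiles G
    X≡ : ∀ c → card G (step G P S c) ≡ indicatorSum (n G) (λ w c → step G P S c w) c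
    X≡ c = card-count G (step G P S c)

module Moments where
  open import Data.Nat using (ℕ; suc) renaming (_+_ to _+ℕ_; _*_ to _*ℕ_; _≤_ to _≤ℕ_)
  open import Data.Integer using (+_; +≤+) renaming (_*_ to _*ℤ_; _+_ to _+ℤ_; _≤_ to _≤ℤ_)
  open import Data.Integer.Tactic.RingSolver using () renaming (solve-∀ to ℤ-solve-∀)
  import Data.Integer.Properties as ℤ
  open import Data.Nat.Coprimality using (1-coprimeTo) renaming (sym to coprime-sym)
  open import Data.List using (List; []; _∷_; length; map)
  open import Data.List.Properties using (length-map)
  open import Data.Maybe using (Maybe; nothing; just)
  open import Relation.Nullary using (yes; no)
  open import Data.Rational using (ℚ; mkℚ; _+_; _*_; _-_; -_; _/_; _≤_; 0ℚ; 1ℚ; NonNegative)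
  open import Data.Rational.Properties
    using ( normalize-coprime; toℚᵘ-injective; toℚᵘ-homo-+; toℚᵘ-homo-*; toℚᵘ-cancel-≤
          ; _≟_; +-*-commutativeRing; *-inverseʳ; *-identityʳ; ≤-refl; *-monoʳ-≤-nonNeg; +-monoˡ-≤; normalize-nonNeg
          ; module ≤-Reasoning)
  import Data.Rational.Unnormalised as ℚᵘ
  import Data.Rational.Unnormalised.Properties as ℚᵘ
  open import Relation.Binary.PropositionalEquality
  open import Level using (0ℓ)
  open import Tactic.RingSolver using (solve-∀)
  open import Tactic.RingSolver.Core.AlmostCommutativeRing using (AlmostCommutativeRing; fromCommutativeRing)
  open import Defs using (sumℚ; mean; variance)
  open Counting using (sumL)

  isZero : (x : ℚ) → Maybe (0ℚ ≡ x)
  isZero x with x ≟ 0ℚ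
  ... | yes x≡0 = just (sym x≡0)
  ... | no _    = nothing

  ℚ-ring : AlmostCommutativeRing 0ℓ 0ℓ
  ℚ-ring = fromCommutativeRing +-*-commutativeRing isZero

  toℚ : ℕ → ℚ
  toℚ k = (+ k) / 1

  normalForm : ℕ → ℚ
  normalForm k = mkℚ (+ k) 0 (coprime-sym (1-coprimeTo k))

  toℚ-normal : ∀ k → toℚ k ≡ normalForm k
  toℚ-normal k = normalize-coprime (coprime-sym (1-coprimeTo k))

  toℚ-+ : ∀ a b → toℚ (a +ℕ b) ≡ toℚ a + toℚ b
  toℚ-+ a b rewrite toℚ-normal (a +ℕ b) | toℚ-normal a | toℚ-normal b =
    toℚᵘ-injective (ℚᵘ.≃-trans (ℚᵘ.*≡* (trans (cong (_*ℤ + 1) (ℤ.pos-+ a b)) (unit-denominators (+ a) (+ b)))) (ℚᵘ.≃-sym (toℚᵘ-homo-+ (normalForm a) (normalForm b))))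

    where
    unit-denominators : ∀ x y → (x +ℤ y) *ℤ + 1 ≡ (x *ℤ + 1 +ℤ y *ℤ + 1) *ℤ + 1
    unit-denominators = ℤ-solve-∀

  toℚ-* : ∀ a b → toℚ (a *ℕ b) ≡ toℚ a * toℚ b
  toℚ-* a b rewrite toℚ-normal (a *ℕ b) | toℚ-normal a | toℚ-normal b =
    toℚᵘ-injective (ℚᵘ.≃-trans (ℚᵘ.*≡* (cong (_*ℤ + 1) (ℤ.pos-* a b))) (ℚᵘ.≃-sym (toℚᵘ-homo-* (normalForm a) (normalForm b))))

  toℚ-mono : ∀ {a b} → a ≤ℕ b → toℚ a ≤ toℚ b
  toℚ-mono {a} {b} a≤b rewrite toℚ-normal a | toℚ-normal b =
    toℚᵘ-cancel-≤ (ℚᵘ.*≤* (subst₂ _≤ℤ_ (sym (ℤ.*-identityʳ (+ a))) (sym (ℤ.*-identityʳ (+ b))) (+≤+ a≤b)))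

  sumℚ-toℚ : {A : Set} (f : A → ℕ) → ∀ L → sumℚ (map (λ c → toℚ (f c)) L) ≡ toℚ (sumL f L)
  sumℚ-toℚ f []      = refl
  sumℚ-toℚ f (c ∷ L) = trans (cong (_+_ (toℚ (f c))) (sumℚ-toℚ f L)) (sym (toℚ-+ (f c) (sumL f L)))

  square : ℚ → ℚ
  square x = x * x

  sumℚ-toℚ-square : {A : Set} (f : A → ℕ) → ∀ L →
    sumℚ (map square (map (λ c → toℚ (f c)) L)) ≡ toℚ (sumL (λ c → f c *ℕ f c) L)
  sumℚ-toℚ-square f []      = refl
  sumℚ-toℚ-square f (c ∷ L) =
    trans (cong₂ _+_ (sym (toℚ-* (f c) (f c))) (sumℚ-toℚ-square f L)) (sym (toℚ-+ (f c *ℕ f c) _))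

  weight : ℕ → ℚ
  weight ℓ = (+ 1) / suc ℓ

  weight-nonNeg : ∀ ℓ → NonNegative (weight ℓ)
  weight-nonNeg ℓ = normalize-nonNeg 1 (suc ℓ)

  weight-inverse : ∀ ℓ → toℚ (suc ℓ) * weight ℓ ≡ 1ℚ
  weight-inverse ℓ rewrite toℚ-normal (suc ℓ) | normalize-coprime {1} {ℓ} (1-coprimeTo (suc ℓ)) =
    *-inverseʳ (normalForm (suc ℓ))

  sum-squared-deviations : (m : ℚ) → ∀ ys →
    sumℚ (map (λ y → (y - m) * (y - m)) ys) ≡ sumℚ (map square ys) - (m + m) * sumℚ ys + toℚ (length ys) * (m * m)
  sum-squared-deviations m []       = empty-sum m
    where
    empty-sum : ∀ m → 0ℚ ≡ 0ℚ - (m + m) * 0ℚ + 0ℚ * (m * m)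
    empty-sum = solve-∀ ℚ-ring
  sum-squared-deviations m (y ∷ ys) = begin
      (y - m) * (y - m) + sumℚ (map (λ y → (y - m) * (y - m)) ys)
    ≡⟨ cong (_+_ ((y - m) * (y - m))) (sum-squared-deviations m ys) ⟩
      (y - m) * (y - m) + (sumℚ (map square ys) - (m + m) * sumℚ ys + toℚ (length ys) * (m * m))
    ≡⟨ expand y m (sumℚ (map square ys)) (sumℚ ys) (toℚ (length ys)) ⟩
      (y * y + sumℚ (map square ys)) - (m + m) * (y + sumℚ ys) + (1ℚ + toℚ (length ys)) * (m * m)
    ≡⟨ cong (λ k → (y * y + sumℚ (map square ys)) - (m + m) * (y + sumℚ ys) + k * (m * m)) (sym (toℚ-+ 1 (length ys))) ⟩
      (y * y + sumℚ (map square ys)) - (m + m) * (y + sumℚ ys) + toℚ (suc (length ys)) * (m * m)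
    ∎
    where
    open ≡-Reasoning
    expand : ∀ y m s₂ s₁ k → (y - m) * (y - m) + (s₂ - (m + m) * s₁ + k * (m * m))
                            ≡ (y * y + s₂) - (m + m) * (y + s₁) + (1ℚ + k) * (m * m)
    expand = solve-∀ ℚ-ring

  variance-formula : ∀ y ys →
    variance (y ∷ ys) ≡ sumℚ (map square (y ∷ ys)) * weight (length ys) - mean (y ∷ ys) * mean (y ∷ ys)
  variance-formula y ys = begin
      sumℚ (map (λ x → (x - q) * (x - q)) (y ∷ ys)) * weight (length (map (λ x → (x - q) * (x - q)) ys))
    ≡⟨ cong₂ (λ s ℓ → s * weight ℓ) (sum-squared-deviations q (y ∷ ys)) (length-map _ ys) ⟩
      (s₂ - (q + q) * s₁ + toℚ (length (y ∷ ys)) * (q * q)) * r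
    ≡⟨ simplify s₂ s₁ (toℚ (suc (length ys))) r (weight-inverse (length ys)) ⟩
      s₂ * r - q * q
    ∎
    where
    open ≡-Reasoning
    s₁ = sumℚ (y ∷ ys)
    s₂ = sumℚ (map square (y ∷ ys))
    r  = weight (length ys)
    q  = mean (y ∷ ys)
    simplify : ∀ s₂ s₁ k r → k * r ≡ 1ℚ →
      (s₂ - (s₁ * r + s₁ * r) * s₁ + k * ((s₁ * r) * (s₁ * r))) * r ≡ s₂ * r - (s₁ * r) * (s₁ * r)
    simplify s₂ s₁ k r kr = begin
        (s₂ - (s₁ * r + s₁ * r) * s₁ + k * ((s₁ * r) * (s₁ * r))) * r
      ≡⟨ regroup s₂ s₁ k r ⟩
        s₂ * r - (s₁ * r) * (s₁ * r) - (s₁ * r) * (s₁ * r) + ((s₁ * r) * (s₁ * r)) * (k * r)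
      ≡⟨ cong (λ u → s₂ * r - (s₁ * r) * (s₁ * r) - (s₁ * r) * (s₁ * r) + ((s₁ * r) * (s₁ * r)) * u) kr ⟩
        s₂ * r - (s₁ * r) * (s₁ * r) - (s₁ * r) * (s₁ * r) + ((s₁ * r) * (s₁ * r)) * 1ℚ
      ≡⟨ collapse (s₂ * r) ((s₁ * r) * (s₁ * r)) ⟩
        s₂ * r - (s₁ * r) * (s₁ * r)
      ∎
      where
      regroup : ∀ s₂ s₁ k r → (s₂ - (s₁ * r + s₁ * r) * s₁ + k * ((s₁ * r) * (s₁ * r))) * r
        ≡ s₂ * r - (s₁ * r) * (s₁ * r) - (s₁ * r) * (s₁ * r) + ((s₁ * r) * (s₁ * r)) * (k * r)
      regroup = solve-∀ ℚ-ring
      collapse : ∀ a b → a - b - b + b * 1ℚ ≡ a - b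
      collapse = solve-∀ ℚ-ring

  scale-bound : ∀ k r s₂ s₁ → k * r ≡ 1ℚ → NonNegative r →
    k * s₂ ≤ s₁ * s₁ + k * s₁ → s₂ * r ≤ (s₁ * r) * (s₁ * r) + s₁ * r
  scale-bound k r s₂ s₁ kr r≥0 h = begin
      s₂ * r
    ≡⟨ sym (*-identityʳ (s₂ * r)) ⟩
      s₂ * r * 1ℚ
    ≡⟨ cong (_*_ (s₂ * r)) (sym kr) ⟩
      s₂ * r * (k * r)
    ≡⟨ left k s₂ r ⟩
      k * s₂ * r * r
    ≤⟨ *-monoʳ-≤-nonNeg r {{r≥0}} (*-monoʳ-≤-nonNeg r {{r≥0}} h) ⟩
      (s₁ * s₁ + k * s₁) * r * r
    ≡⟨ right k s₁ r ⟩
      (s₁ * r) * (s₁ * r) + s₁ * r * (k * r)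
    ≡⟨ cong (λ u → (s₁ * r) * (s₁ * r) + s₁ * r * u) kr ⟩
      (s₁ * r) * (s₁ * r) + s₁ * r * 1ℚ
    ≡⟨ cong (_+_ ((s₁ * r) * (s₁ * r))) (*-identityʳ (s₁ * r)) ⟩
      (s₁ * r) * (s₁ * r) + s₁ * r
    ∎
    where
    open ≤-Reasoning
    left : ∀ k s₂ r → s₂ * r * (k * r) ≡ k * s₂ * r * r
    left = solve-∀ ℚ-ring
    right : ∀ k s₁ r → (s₁ * s₁ + k * s₁) * r * r ≡ (s₁ * r) * (s₁ * r) + s₁ * r * (k * r)
    right = solve-∀ ℚ-ring

  variance-≤-mean : ∀ ys →
    toℚ (length ys) * sumℚ (map square ys) ≤ sumℚ ys * sumℚ ys + toℚ (length ys) * sumℚ ys →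
    variance ys ≤ mean ys
  variance-≤-mean []       _ = ≤-refl
  variance-≤-mean (y ∷ ys) h = begin
      variance (y ∷ ys)
    ≡⟨ variance-formula y ys ⟩
      sumℚ (map square (y ∷ ys)) * r - q * q
    ≤⟨ +-monoˡ-≤ (- (q * q)) (scale-bound (toℚ (suc (length ys))) r (sumℚ (map square (y ∷ ys))) (sumℚ (y ∷ ys)) (weight-inverse (length ys)) (weight-nonNeg (length ys)) h) ⟩
      q * q + q - q * q
    ≡⟨ cancel (q * q) q ⟩
      q
    ∎
    where
    open ≤-Reasoning
    r = weight (length ys)
    q = mean (y ∷ ys)
    cancel : ∀ a b → a + b - a ≡ b
    cancel = solve-∀ ℚ-ring

  variance-≤-mean-ℕ : {A : Set} (L : List A) (f : A → ℕ) →
    length L *ℕ sumL (λ c → f c *ℕ f c) L ≤ℕ sumL f L *ℕ sumL f L +ℕ length L *ℕ sumL f L →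
    variance (map (λ c → toℚ (f c)) L) ≤ mean (map (λ c → toℚ (f c)) L)
  variance-≤-mean-ℕ L f h = variance-≤-mean (map (λ c → toℚ (f c)) L) (subst₂ _≤_ lhs rhs (toℚ-mono h))
    where
    N  = length L
    S₁ = sumL f L
    lhs : toℚ (N *ℕ sumL (λ c → f c *ℕ f c) L) ≡ toℚ (length (map (λ c → toℚ (f c)) L)) * sumℚ (map square (map (λ c → toℚ (f c)) L))
    lhs = trans (toℚ-* N _) (cong₂ (λ n s → toℚ n * s) (sym (length-map _ L)) (sym (sumℚ-toℚ-square f L)))
    rhs : toℚ (S₁ *ℕ S₁ +ℕ N *ℕ S₁) ≡ sumℚ (map (λ c → toℚ (f c)) L) * sumℚ (map (λ c → toℚ (f c)) L) + toℚ (length (map (λ c → toℚ (f c)) L)) * sumℚ (map (λ c → toℚ (f c)) L)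
    rhs = begin
        toℚ (S₁ *ℕ S₁ +ℕ N *ℕ S₁)
      ≡⟨ trans (toℚ-+ (S₁ *ℕ S₁) (N *ℕ S₁)) (cong₂ _+_ (toℚ-* S₁ S₁) (toℚ-* N S₁)) ⟩
        toℚ S₁ * toℚ S₁ + toℚ N * toℚ S₁
      ≡⟨ cong₂ (λ n s → s * s + toℚ n * s) (sym (length-map _ L)) (sym (sumℚ-toℚ f L)) ⟩
        sumℚ (map (λ c → toℚ (f c)) L) * sumℚ (map (λ c → toℚ (f c)) L) + toℚ (length (map (λ c → toℚ (f c)) L)) * sumℚ (map (λ c → toℚ (f c)) L)
      ∎
      where open ≡-Reasoning

open import Defs
open import Data.Nat using (_≥_)
open import Data.Fin using (Fin)
open import Data.Rational using (_≤_)
open OneRound using (informed-count-bound)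
open Moments using (variance-≤-mean-ℕ)

lemma2p1 : (G : Graph) → (∀ (v : Fin (n G)) → deg G v ≥ 1) →
    (P : Protocol) → (S : VSet G) → condVar G P S ≤ condE G P S
lemma2p1 G _ P S =
  variance-≤-mean-ℕ (allProfiles G) (λ c → card G (step G P S c)) (informed-count-bound G P S)
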